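{- Let $a,b,c$ be non-negative integers and let $(a',b',c')$ be any permutation of $(a,b,c)$. Then $$\sum_{k=0}^a k\binom{a+b}{a+k}\binom{b+c}{b+k}\binom{c+a}{c+k}=\frac{a'\,Q_{a',b'}}{2}\sum_{j=0}^{c'-1}\binom{a'+j}{a'}\binom{b'+j}{b'-1}.$$
   Context: For integers $x,y$, $Q_{x,y}:=\binom{x+y}{x}$. Convention: an empty sum equals $0$, and $\binom{N}{k}=0$ whenever $k<0$ or $k>N$. -}

module Defs where

open import Data.Nat using (ℕ; zero; suc; _+_; _*_; _∸_)
open import Data.Nat.Combinatorics using (_C_)

sumTo : ℕ → (ℕ → ℕ) → ℕ
sumTo zero    f = f 0
sumTo (suc n) f = sumTo n f + f (suc n)

sumBelow : ℕ → (ℕ → ℕ) → ℕ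
sumBelow zero    f = 0
sumBelow (suc n) f = sumBelow n f + f n

-- binomial with integer lower index m - 1 (for natural m): binom(N, m-1),
-- which is 0 when m = 0 (lower index -1 < 0)
choosePred : ℕ → ℕ → ℕ
choosePred N zero    = 0
choosePred N (suc m) = N C m

Q : ℕ → ℕ → ℕ
Q x y = (x + y) C x

LHS : ℕ → ℕ → ℕ → ℕ
LHS a b c = sumTo a (λ k → k * (((a + b) C (a + k)) * (((b + c) C (b + k)) * ((c + a) C (c + k)))))

RHSsum : ℕ → ℕ → ℕ → ℕ
RHSsum a' b' c' = sumBelow c' (λ j → ((a' + j) C a') * choosePred (b' + j) b')

-- For fixed a, b induct on c. With X_c(k) = C(a+b,a+k)·C(b+c,b+k)·C(c+a,c+k) and the
-- boundary term W_c(k) = (a+k)·C(a+b,a+k)·C(b+c,b+k-1)·C(c+a,c+k), the absorption identity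
-- k·C(n+1,k) = (n+1)·C(n,k-1) applied to the three factors gives
--   W_c(k) + 2k·X_c(k) = W_c(k+1) + 2k·X_{c+1}(k).
-- Summing over 0 ≤ k ≤ a telescopes (W_c(a+1) = 0): raising c by one adds
-- W_c(0) = a·Q_{a,b}·C(a+c,a)·C(b+c,b-1), the j = c term on the right, to twice the left side.
-- Any permutation is then reached because the left side is invariant under rotating (a,b,c)
-- and the right side under a ↔ b, since a·C(a+j,a) = (j+1)·C(a+j,a-1).
module Submission where

open import Defs
open import Data.Nat using (ℕ; zero; suc; _+_; _*_; _<_; s≤s; z≤n)
open import Data.Nat.Properties
open import Data.Nat.Combinatorics using (_C_; k>n⇒nCk≡0; nC1≡n; nCk≡nC[n∸k]; nCk+nC[k+1]≡[n+1]C[k+1])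
open import Data.Nat.Tactic.RingSolver using (solve-∀)
open import Data.List using (List; _∷_; []; _++_; [_])
open import Data.List.Properties using (++-assoc)
open import Data.List.Relation.Binary.Permutation.Propositional as ↭ using (_↭_)
open import Relation.Binary.PropositionalEquality using (_≡_; refl; sym; trans; cong; cong₂)
open Relation.Binary.PropositionalEquality.≡-Reasoning

pascal : ∀ n k → suc n C suc k ≡ n C k + n C suc k
pascal n k = sym (nCk+nC[k+1]≡[n+1]C[k+1] n k)

pascal-choosePred : ∀ n k → suc n C k ≡ choosePred n k + n C k
pascal-choosePred n zero    = refl
pascal-choosePred n (suc k) = pascal n k

C-sym : ∀ m n → (m + n) C n ≡ (m + n) C m
C-sym m n = trans (nCk≡nC[n∸k] (m≤n+m n m)) (cong ((m + n) C_) (m+n∸n≡m m n))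

absorption : ∀ n k → suc k * (suc n C suc k) ≡ suc n * (n C k)
absorption n zero = trans (+-identityʳ (suc n C 1)) (trans (nC1≡n (suc n)) (sym (*-identityʳ (suc n))))
absorption zero (suc k) =
  trans (cong (suc (suc k) *_) (k>n⇒nCk≡0 {1} {suc (suc k)} (s≤s (s≤s z≤n)))) (*-zeroʳ (suc (suc k)))
absorption (suc n) (suc k) = begin
  suc (suc k) * (suc (suc n) C suc (suc k))    ≡⟨ cong (suc (suc k) *_) (pascal (suc n) (suc k)) ⟩
  suc (suc k) * (A + suc n C suc (suc k))      ≡⟨ split (suc k) A _ ⟩
  suc k * A + A + suc (suc k) * (suc n C suc (suc k))
                                               ≡⟨ cong₂ (λ u v → u + A + v) (absorption n k) (absorption n (suc k)) ⟩
  suc n * (n C k) + A + suc n * (n C suc k)    ≡⟨ merge (suc n) (n C k) _ A ⟩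
  suc n * (n C k + n C suc k) + A              ≡⟨ cong (λ u → suc n * u + A) (sym (pascal n k)) ⟩
  suc n * A + A                                ≡⟨ +-comm (suc n * A) A ⟩
  suc (suc n) * A                              ∎
  where
  A : ℕ
  A = suc n C suc k
  split : ∀ m x y → suc m * (x + y) ≡ m * x + x + suc m * y
  split = solve-∀
  merge : ∀ m x y z → m * x + z + m * y ≡ m * (x + y) + z
  merge = solve-∀

absorption-choosePred : ∀ n k → k * (suc n C k) ≡ suc n * choosePred n k
absorption-choosePred n zero    = sym (*-zeroʳ (suc n))
absorption-choosePred n (suc k) = absorption n k

*-C≡suc*choosePred : ∀ m n → m * ((m + n) C m) ≡ suc n * choosePred (m + n) m
*-C≡suc*choosePred zero    n = sym (*-zeroʳ (suc n))
*-C≡suc*choosePred (suc m) n = begin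
  suc m * (suc (m + n) C suc m)        ≡⟨ absorption (m + n) m ⟩
  suc (m + n) * ((m + n) C m)          ≡⟨ cong (suc (m + n) *_) (C-sym m n) ⟨
  suc (m + n) * ((m + n) C n)          ≡⟨ absorption (m + n) n ⟨
  suc n * (suc (m + n) C suc n)        ≡⟨ cong (λ l → suc n * (l C suc n)) (+-suc m n) ⟨
  suc n * ((m + suc n) C suc n)        ≡⟨ cong (suc n *_) (C-sym m (suc n)) ⟩
  suc n * ((m + suc n) C m)            ≡⟨ cong (λ l → suc n * (l C m)) (+-suc m n) ⟩
  suc n * (suc (m + n) C m)            ∎

sumTo-cong : ∀ n {f g : ℕ → ℕ} → (∀ k → f k ≡ g k) → sumTo n f ≡ sumTo n g
sumTo-cong zero    f≡g = f≡g 0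
sumTo-cong (suc n) f≡g = cong₂ _+_ (sumTo-cong n f≡g) (f≡g (suc n))

*-distribˡ-sumTo : ∀ m n (f : ℕ → ℕ) → m * sumTo n f ≡ sumTo n (λ k → m * f k)
*-distribˡ-sumTo m zero    f = refl
*-distribˡ-sumTo m (suc n) f =
  trans (*-distribˡ-+ m (sumTo n f) (f (suc n))) (cong (_+ m * f (suc n)) (*-distribˡ-sumTo m n f))

sumTo-extend : ∀ n m (f : ℕ → ℕ) → (∀ k → n < k → f k ≡ 0) → sumTo (n + m) f ≡ sumTo n f
sumTo-extend n zero    f f≡0 = cong (λ l → sumTo l f) (+-identityʳ n)
sumTo-extend n (suc m) f f≡0 = begin
  sumTo (n + suc m) f                  ≡⟨ cong (λ l → sumTo l f) (+-suc n m) ⟩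
  sumTo (n + m) f + f (suc (n + m))    ≡⟨ cong (sumTo (n + m) f +_) (f≡0 _ (s≤s (m≤m+n n m))) ⟩
  sumTo (n + m) f + 0                  ≡⟨ +-identityʳ _ ⟩
  sumTo (n + m) f                      ≡⟨ sumTo-extend n m f f≡0 ⟩
  sumTo n f                            ∎

sumTo-telescope : ∀ (f g h : ℕ → ℕ) → (∀ k → f k + g k ≡ f (suc k) + h k) →
                  ∀ n → f 0 + sumTo n g ≡ f (suc n) + sumTo n h
sumTo-telescope f g h step zero    = step 0
sumTo-telescope f g h step (suc n) = begin
  f 0 + (sumTo n g + g (suc n))             ≡⟨ +-assoc (f 0) _ _ ⟨
  f 0 + sumTo n g + g (suc n)               ≡⟨ cong (_+ g (suc n)) (sumTo-telescope f g h step n) ⟩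
  f (suc n) + sumTo n h + g (suc n)         ≡⟨ [x+y]+z≡[x+z]+y (f (suc n)) (sumTo n h) (g (suc n)) ⟩
  f (suc n) + g (suc n) + sumTo n h         ≡⟨ cong (_+ sumTo n h) (step (suc n)) ⟩
  f (suc (suc n)) + h (suc n) + sumTo n h   ≡⟨ [x+y]+z≡x+[z+y] (f (suc (suc n))) (h (suc n)) (sumTo n h) ⟩
  f (suc (suc n)) + (sumTo n h + h (suc n)) ∎
  where
  [x+y]+z≡[x+z]+y : ∀ x y z → x + y + z ≡ x + z + y
  [x+y]+z≡[x+z]+y = solve-∀
  [x+y]+z≡x+[z+y] : ∀ x y z → x + y + z ≡ x + (z + y)
  [x+y]+z≡x+[z+y] = solve-∀

-- The hypotheses are the absorption identity for N = C(a+b,a+k), α = C(b+c,b+k-1) and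
-- γ = C(c+a,c+k), each written with its Pascal neighbour N', β, δ; the conclusion is
-- W_c(k) + 2k·X_c(k) = W_c(k+1) + 2k·X_{c+1}(k) in these variables. Over ℤ the difference
-- of the two sides is  -Nα·(γ-hypothesis) - Nδ·(α-hypothesis) - βδ·(N-hypothesis),
-- which is the certificate below with all terms moved to the side where they are positive.
telescoping-identity : ∀ a b c k N N' α β γ δ →
  suc (a + k) * (N + N') ≡ suc (a + b) * N →
  (b + k) * (α + β) ≡ suc (b + c) * α →
  suc (c + k) * (γ + δ) ≡ suc (c + a) * γ →
  (a + k) * (N * (α * γ)) + 2 * (k * (N * (β * γ)))
    ≡ suc (a + k) * (N' * (β * δ)) + 2 * (k * (N * ((α + β) * (γ + δ))))
telescoping-identity a b c k N N' α β γ δ hN hα hγ = +-cancelʳ-≡ Zʳ L R (begin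
  L + Zʳ  ≡⟨ cong (L +_) Zˡ≡Zʳ ⟨
  L + Zˡ  ≡⟨ certificate a b c k N N' α β γ δ ⟩
  R + Zʳ  ∎)
  where
  L R Zˡ Zʳ : ℕ
  L  = (a + k) * (N * (α * γ)) + 2 * (k * (N * (β * γ)))
  R  = suc (a + k) * (N' * (β * δ)) + 2 * (k * (N * ((α + β) * (γ + δ))))
  Zˡ = N * α * (suc (c + k) * (γ + δ)) + N * δ * ((b + k) * (α + β)) + β * δ * (suc (a + k) * (N + N'))
  Zʳ = N * α * (suc (c + a) * γ) + N * δ * (suc (b + c) * α) + β * δ * (suc (a + b) * N)
  Zˡ≡Zʳ : Zˡ ≡ Zʳ
  Zˡ≡Zʳ = cong₂ _+_ (cong₂ _+_ (cong (N * α *_) hγ) (cong (N * δ *_) hα)) (cong (β * δ *_) hN)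
  certificate : ∀ a b c k N N' α β γ δ →
    (a + k) * (N * (α * γ)) + 2 * (k * (N * (β * γ)))
      + (N * α * (suc (c + k) * (γ + δ)) + N * δ * ((b + k) * (α + β)) + β * δ * (suc (a + k) * (N + N')))
    ≡ suc (a + k) * (N' * (β * δ)) + 2 * (k * (N * ((α + β) * (γ + δ))))
      + (N * α * (suc (c + a) * γ) + N * δ * (suc (b + c) * α) + β * δ * (suc (a + b) * N))
  certificate = solve-∀

x*[y*[z*0]]≡0 : ∀ x y z → x * (y * (z * 0)) ≡ 0
x*[y*[z*0]]≡0 = solve-∀

binomial-triple : ℕ → ℕ → ℕ → ℕ → ℕ
binomial-triple a b c k = ((a + b) C (a + k)) * (((b + c) C (b + k)) * ((c + a) C (c + k)))

boundary : ℕ → ℕ → ℕ → ℕ → ℕ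
boundary a b c k = (a + k) * (((a + b) C (a + k)) * (choosePred (b + c) (b + k) * ((c + a) C (c + k))))

boundary-step : ∀ a b c k →
  boundary a b c k + 2 * (k * binomial-triple a b c k) ≡ boundary a b c (suc k) + 2 * (k * binomial-triple a b (suc c) k)
boundary-step a b c k
  rewrite +-suc a k | +-suc b k | +-suc c k | +-suc b c
        | pascal-choosePred (b + c) (b + k) | pascal (c + a) (c + k) =
  telescoping-identity a b c k _ _ _ _ _ _
    (trans (cong (suc (a + k) *_) (sym (pascal (a + b) (a + k)))) (absorption (a + b) (a + k)))
    (trans (cong ((b + k) *_) (sym (pascal-choosePred (b + c) (b + k)))) (absorption-choosePred (b + c) (b + k)))
    (trans (cong (suc (c + k) *_) (sym (pascal (c + a) (c + k)))) (absorption (c + a) (c + k)))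

boundary-zero : ∀ a b c → boundary a b c 0 ≡ a * Q a b * (((a + c) C a) * choosePred (b + c) b)
boundary-zero a b c rewrite +-identityʳ a | +-identityʳ b | +-identityʳ c = begin
  a * (((a + b) C a) * (choosePred (b + c) b * ((c + a) C c)))
    ≡⟨ cong (λ x → a * (((a + b) C a) * (choosePred (b + c) b * x))) (trans (cong (_C a) (+-comm a c)) (C-sym c a)) ⟨
  a * (((a + b) C a) * (choosePred (b + c) b * ((a + c) C a)))
    ≡⟨ reorder a ((a + b) C a) ((a + c) C a) (choosePred (b + c) b) ⟩
  a * Q a b * (((a + c) C a) * choosePred (b + c) b) ∎
  where
  reorder : ∀ a q x y → a * (q * (y * x)) ≡ a * q * (x * y)
  reorder = solve-∀

boundary-top : ∀ a b c → boundary a b c (suc a) ≡ 0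
boundary-top a b c
  rewrite k>n⇒nCk≡0 {c + a} {c + suc a} (+-monoʳ-< c (n<1+n a)) =
  x*[y*[z*0]]≡0 (a + suc a) ((a + b) C (a + suc a)) (choosePred (b + c) (b + suc a))

summand-vanishes : ∀ a b c k → a < k → k * binomial-triple a b c k ≡ 0
summand-vanishes a b c k a<k
  rewrite k>n⇒nCk≡0 {c + a} {c + k} (+-monoʳ-< c a<k) =
  x*[y*[z*0]]≡0 k ((a + b) C (a + k)) ((b + c) C (b + k))

binomial-triple-rotate : ∀ a b c k → binomial-triple a b c k ≡ binomial-triple b c a k
binomial-triple-rotate a b c k = trans (*-comm ((a + b) C (a + k)) _) (*-assoc ((b + c) C (b + k)) _ _)

LHS-cyclic : ∀ a b c → LHS a b c ≡ LHS b c a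
LHS-cyclic a b c = begin
  sumTo a f          ≡⟨ sumTo-extend a b f (summand-vanishes a b c) ⟨
  sumTo (a + b) f    ≡⟨ sumTo-cong (a + b) (λ k → cong (k *_) (binomial-triple-rotate a b c k)) ⟩
  sumTo (a + b) g    ≡⟨ cong (λ n → sumTo n g) (+-comm a b) ⟩
  sumTo (b + a) g    ≡⟨ sumTo-extend b a g (summand-vanishes b c a) ⟩
  sumTo b g          ∎
  where
  f g : ℕ → ℕ
  f k = k * binomial-triple a b c k
  g k = k * binomial-triple b c a k

LHS-step : ∀ a b c → boundary a b c 0 + 2 * LHS a b c ≡ 2 * LHS a b (suc c)
LHS-step a b c = begin
  boundary a b c 0 + 2 * LHS a b c                ≡⟨ cong (boundary a b c 0 +_) (*-distribˡ-sumTo 2 a _) ⟩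
  boundary a b c 0 + sumTo a (twice-summand c)    ≡⟨ sumTo-telescope (boundary a b c) _ _ (boundary-step a b c) a ⟩
  boundary a b c (suc a) + sumTo a (twice-summand (suc c))
                                                  ≡⟨ cong₂ _+_ (boundary-top a b c) (sym (*-distribˡ-sumTo 2 a _)) ⟩
  2 * LHS a b (suc c)                             ∎
  where
  twice-summand : ℕ → ℕ → ℕ
  twice-summand d k = 2 * (k * binomial-triple a b d k)

2*LHS≡a*Q*RHSsum : ∀ a b c → 2 * LHS a b c ≡ a * Q a b * RHSsum a b c
-- after two rotations c = 0 comes first, leaving the single term k = 0
2*LHS≡a*Q*RHSsum a b zero    = trans (cong (2 *_) (trans (LHS-cyclic a b 0) (LHS-cyclic b 0 a))) (sym (*-zeroʳ (a * Q a b)))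
2*LHS≡a*Q*RHSsum a b (suc c) = begin
  2 * LHS a b (suc c)                                   ≡⟨ LHS-step a b c ⟨
  boundary a b c 0 + 2 * LHS a b c                      ≡⟨ cong₂ _+_ (boundary-zero a b c) (2*LHS≡a*Q*RHSsum a b c) ⟩
  a * Q a b * term + a * Q a b * RHSsum a b c           ≡⟨ +-comm (a * Q a b * term) _ ⟩
  a * Q a b * RHSsum a b c + a * Q a b * term           ≡⟨ *-distribˡ-+ (a * Q a b) _ _ ⟨
  a * Q a b * RHSsum a b (suc c)                        ∎
  where
  term : ℕ
  term = ((a + c) C a) * choosePred (b + c) b

Q-comm : ∀ a b → Q a b ≡ Q b a
Q-comm a b = trans (sym (C-sym a b)) (cong (_C b) (+-comm a b))

*-RHSsum-comm : ∀ a b c → a * RHSsum a b c ≡ b * RHSsum b a c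
*-RHSsum-comm a b zero    = trans (*-zeroʳ a) (sym (*-zeroʳ b))
*-RHSsum-comm a b (suc c) = begin
  a * (RHSsum a b c + term a b)           ≡⟨ *-distribˡ-+ a _ _ ⟩
  a * RHSsum a b c + a * term a b         ≡⟨ cong₂ _+_ (*-RHSsum-comm a b c) *-term-comm ⟩
  b * RHSsum b a c + b * term b a         ≡⟨ *-distribˡ-+ b _ _ ⟨
  b * (RHSsum b a c + term b a)           ∎
  where
  term : ℕ → ℕ → ℕ
  term x y = ((x + c) C x) * choosePred (y + c) y
  p : ℕ → ℕ
  p x = choosePred (x + c) x
  *-term : ∀ x y → x * term x y ≡ suc c * (p x * p y)
  *-term x y = trans (sym (*-assoc x ((x + c) C x) (p y)))
    (trans (cong (_* p y) (*-C≡suc*choosePred x c)) (*-assoc (suc c) (p x) (p y)))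
  *-term-comm : a * term a b ≡ b * term b a
  *-term-comm = trans (*-term a b) (trans (cong (suc c *_) (*-comm (p a) (p b))) (sym (*-term b a)))

RHS-comm : ∀ a b c → a * Q a b * RHSsum a b c ≡ b * Q b a * RHSsum b a c
RHS-comm a b c = begin
  a * Q a b * RHSsum a b c       ≡⟨ cong (_* RHSsum a b c) (*-comm a (Q a b)) ⟩
  Q a b * a * RHSsum a b c       ≡⟨ *-assoc (Q a b) a _ ⟩
  Q a b * (a * RHSsum a b c)     ≡⟨ cong₂ _*_ (Q-comm a b) (*-RHSsum-comm a b c) ⟩
  Q b a * (b * RHSsum b a c)     ≡⟨ *-assoc (Q b a) b _ ⟨
  Q b a * b * RHSsum b a c       ≡⟨ cong (_* RHSsum b a c) (*-comm (Q b a) b) ⟩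
  b * Q b a * RHSsum b a c       ∎

LHS-comm₁₂ : ∀ a b c → LHS a b c ≡ LHS b a c
LHS-comm₁₂ a b c = *-cancelˡ-≡ _ _ 2
  (trans (2*LHS≡a*Q*RHSsum a b c) (trans (RHS-comm a b c) (sym (2*LHS≡a*Q*RHSsum b a c))))

LHS-comm₂₃ : ∀ a b c → LHS a b c ≡ LHS a c b
LHS-comm₂₃ a b c = trans (LHS-cyclic a b c) (trans (LHS-comm₁₂ b c a) (sym (LHS-cyclic a c b)))

module _ {a b} {A : Set a} {B : Set b} (f : List A → B)
         (f-swap : ∀ ws x y ys → f (ws ++ x ∷ y ∷ ys) ≡ f (ws ++ y ∷ x ∷ ys)) where

  ↭-invariant-after : ∀ ws {xs ys} → xs ↭ ys → f (ws ++ xs) ≡ f (ws ++ ys)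
  ↭-invariant-after ws ↭.refl                     = refl
  ↭-invariant-after ws (↭.prep {xs} {ys} x p)     = begin
    f (ws ++ x ∷ xs)              ≡⟨ cong f (++-assoc ws [ x ] xs) ⟨
    f ((ws ++ [ x ]) ++ xs)       ≡⟨ ↭-invariant-after (ws ++ [ x ]) p ⟩
    f ((ws ++ [ x ]) ++ ys)       ≡⟨ cong f (++-assoc ws [ x ] ys) ⟩
    f (ws ++ x ∷ ys)              ∎
  ↭-invariant-after ws (↭.swap {xs} {ys} x y p)   = begin
    f (ws ++ x ∷ y ∷ xs)          ≡⟨ cong f (++-assoc ws (x ∷ y ∷ []) xs) ⟨
    f ((ws ++ x ∷ y ∷ []) ++ xs)  ≡⟨ ↭-invariant-after (ws ++ x ∷ y ∷ []) p ⟩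
    f ((ws ++ x ∷ y ∷ []) ++ ys)  ≡⟨ cong f (++-assoc ws (x ∷ y ∷ []) ys) ⟩
    f (ws ++ x ∷ y ∷ ys)          ≡⟨ f-swap ws x y ys ⟩
    f (ws ++ y ∷ x ∷ ys)          ∎
  ↭-invariant-after ws (↭.trans p q)              = trans (↭-invariant-after ws p) (↭-invariant-after ws q)

  ↭-invariant : ∀ {xs ys} → xs ↭ ys → f xs ≡ f ys
  ↭-invariant = ↭-invariant-after []

-- the value 0 on lists of length other than 3 is junk
LHS-list : List ℕ → ℕ
LHS-list (a ∷ b ∷ c ∷ []) = LHS a b c
LHS-list _                = 0

LHS-list-swap : ∀ ws x y ys → LHS-list (ws ++ x ∷ y ∷ ys) ≡ LHS-list (ws ++ y ∷ x ∷ ys)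
LHS-list-swap []                  x y []          = refl
LHS-list-swap []                  x y (z ∷ [])    = LHS-comm₁₂ x y z
LHS-list-swap []                  x y (_ ∷ _ ∷ _) = refl
LHS-list-swap (w ∷ [])            x y []          = LHS-comm₂₃ w x y
LHS-list-swap (w ∷ [])            x y (_ ∷ _)     = refl
LHS-list-swap (_ ∷ _ ∷ [])        x y _           = refl
LHS-list-swap (_ ∷ _ ∷ _ ∷ [])    x y _           = refl
LHS-list-swap (_ ∷ _ ∷ _ ∷ _ ∷ _) x y _           = refl

corollary2p5 : (a b c a' b' c' : ℕ) → (a ∷ b ∷ c ∷ []) ↭ (a' ∷ b' ∷ c' ∷ []) →
    2 * LHS a b c ≡ (a' * Q a' b') * RHSsum a' b' c'
corollary2p5 a b c a' b' c' p =
  trans (cong (2 *_) (↭-invariant LHS-list LHS-list-swap p)) (2*LHS≡a*Q*RHSsum a' b' c')
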